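{- For every $n \geq 2$, the leading coefficient of $\delta_n$ is a perfect square. Moreover, for every $n \geq 1$, every monomial occurring with nonzero coefficient in $\delta_n$ has even degree.
   Context: The polynomials $\delta_n, \varepsilon_n \in \mathbb{Z}[k]$, $n \geq 1$, are defined by $(\delta_1(k),\varepsilon_1(k)) = (2k^2, k)$ and, for $n \geq 2$, $\delta_n(k) = \delta_{n-1}(k)^2 + \varepsilon_{n-1}(k)^2$, $\varepsilon_n(k) = \delta_{n-1}(k)\varepsilon_{n-1}(k)/k$. -}

module Defs where

open import Data.Nat using (ℕ; zero; suc)
open import Data.Integer using (ℤ; 0ℤ; _+_; _*_)
open import Data.List using (List; []; _∷_)
open import Data.Product using (_×_; _,_; proj₁; proj₂)
open import Relation.Nullary using (yes; no)
open import Data.Integer.Properties using (_≟_)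

-- Polynomials in ℤ[k] as coefficient lists, lowest degree first:
-- a₀ ∷ a₁ ∷ … represents a₀ + a₁ k + a₂ k² + …  (trailing zeros allowed).
Poly : Set
Poly = List ℤ

coeff : Poly → ℕ → ℤ
coeff []       _       = 0ℤ
coeff (a ∷ p)  zero    = a
coeff (a ∷ p)  (suc i) = coeff p i

_⊕_ : Poly → Poly → Poly
[]      ⊕ q       = q
(a ∷ p) ⊕ []      = a ∷ p
(a ∷ p) ⊕ (b ∷ q) = (a + b) ∷ (p ⊕ q)

scale : ℤ → Poly → Poly
scale c []      = []
scale c (a ∷ p) = (c * a) ∷ scale c p

_⊗_ : Poly → Poly → Poly
[]      ⊗ q = []
(a ∷ p) ⊗ q = scale a q ⊕ (0ℤ ∷ (p ⊗ q))

-- division by k: drops the constant coefficient. This is exact division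
-- whenever the constant term is 0, which is the case where it is used below.
divK : Poly → Poly
divK []      = []
divK (a ∷ p) = p

lead : Poly → ℤ
lead []      = 0ℤ
lead (a ∷ p) with lead p ≟ 0ℤ
... | yes _ = a
... | no  _ = lead p

kPoly : Poly
kPoly = 0ℤ ∷ 1ℤ ∷ []
  where open import Data.Integer using (1ℤ)

twoK² : Poly
twoK² = 0ℤ ∷ 0ℤ ∷ (Data.Integer.+ 2) ∷ []
  where import Data.Integer

-- δε n = (δ_n , ε_n) for n ≥ 1; δε 0 is an unused dummy value.
δε : ℕ → Poly × Poly
δε zero          = ([] , [])
δε (suc zero)    = (twoK² , kPoly)
δε (suc (suc n)) with δε (suc n)
... | (d , e) = ((d ⊗ d) ⊕ (e ⊗ e)) , divK (d ⊗ e)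

δ : ℕ → Poly
δ n = proj₁ (δε n)

ε : ℕ → Poly
ε n = proj₂ (δε n)

{-# OPTIONS --safe #-}
-- Inductively deg ε_n < deg δ_n, so δ_{n+1} = δ_n² + ε_n² has degree
-- 2 deg δ_n with leading coefficient the square of that of δ_n, and
-- ε_{n+1} = δ_n ε_n / k again has degree below 2 deg δ_n. For the parities:
-- δ_1 = 2k² is even and ε_1 = k odd; the square of a polynomial supported on
-- one parity class is even, while δ_n ε_n has the parity of ε_n and the
-- division by k flips it.
module Submission where

open import Defs
open import Data.Nat using (ℕ; _≤_)
open import Data.Nat.Divisibility using (_∣_)
open import Data.Integer using (ℤ; 0ℤ; _*_)
open import Data.Product using (_×_; ∃)
open import Relation.Binary.PropositionalEquality using (_≡_; _≢_)

open import Data.Nat as ℕ using (zero; suc; z≤n; s≤s; parity)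
open import Data.Nat.Properties using (≤-trans; ≤-reflexive; n≤1+n; m≤n+m; +-suc)
open import Data.Nat.Divisibility using (divides; ∣m∣n⇒∣m+n; ∣-refl)
open import Data.Integer using (_+_)
open import Data.Integer.Properties
  using (+-identityˡ; +-identityʳ; *-zeroˡ; *-zeroʳ; i*j≡0⇒i≡0∨j≡0) renaming (_≟_ to _≟ℤ_)
open import Data.Parity.Base as ℙ using (Parity; 0ℙ; 1ℙ; _⁻¹)
open import Data.Parity.Properties using (⁻¹-selfInverse; ⁻¹-involutive; p+p≡0ℙ; suc-homo-⁻¹) renaming (_≟_ to _≟ℙ_)
open import Data.List using ([]; _∷_)
open import Data.Product using (_,_; proj₁; map₂; uncurry)
open import Data.Sum using ([_,_]′)
open import Relation.Nullary using (yes; no; contradiction)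
open import Relation.Binary.PropositionalEquality
  using (refl; sym; trans; cong; cong₂; subst; module ≡-Reasoning)

open ≡-Reasoning

coeff-⊕ : ∀ p q i → coeff (p ⊕ q) i ≡ coeff p i + coeff q i
coeff-⊕ []      q       i       = sym (+-identityˡ _)
coeff-⊕ (a ∷ p) []      i       = sym (+-identityʳ _)
coeff-⊕ (a ∷ p) (b ∷ q) zero    = refl
coeff-⊕ (a ∷ p) (b ∷ q) (suc i) = coeff-⊕ p q i

coeff-scale : ∀ c p i → coeff (scale c p) i ≡ c * coeff p i
coeff-scale c []      i       = sym (*-zeroʳ c)
coeff-scale c (a ∷ p) zero    = refl
coeff-scale c (a ∷ p) (suc i) = coeff-scale c p i

coeff-∷⊗ : ∀ x p q i → coeff ((x ∷ p) ⊗ q) i ≡ x * coeff q i + coeff (0ℤ ∷ (p ⊗ q)) i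
coeff-∷⊗ x p q i = trans (coeff-⊕ (scale x q) _ i) (cong (_+ _) (coeff-scale x q i))

DegreeBelow : ℕ → Poly → Set
DegreeBelow n p = ∀ i → n ≤ i → coeff p i ≡ 0ℤ

degreeBelow-mono : ∀ {m n} p → m ≤ n → DegreeBelow m p → DegreeBelow n p
degreeBelow-mono p m≤n hp i n≤i = hp i (≤-trans m≤n n≤i)

degreeBelow-⊕ : ∀ {n} p q → DegreeBelow n p → DegreeBelow n q → DegreeBelow n (p ⊕ q)
degreeBelow-⊕ p q hp hq i n≤i = trans (coeff-⊕ p q i) (cong₂ _+_ (hp i n≤i) (hq i n≤i))

degreeBelow-scale : ∀ {n} c p → DegreeBelow n p → DegreeBelow n (scale c p)
degreeBelow-scale c p hp i n≤i = trans (coeff-scale c p i) (trans (cong (c *_) (hp i n≤i)) (*-zeroʳ c))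

degreeBelow-∷ : ∀ {n} x p → DegreeBelow n p → DegreeBelow (suc n) (x ∷ p)
degreeBelow-∷ x p hp (suc i) (s≤s n≤i) = hp i n≤i

degreeBelow-tail : ∀ {n} x p → DegreeBelow n (x ∷ p) → DegreeBelow (ℕ.pred n) p
degreeBelow-tail {zero}  x p hp i _   = hp (suc i) z≤n
degreeBelow-tail {suc n} x p hp i n≤i = hp (suc i) (s≤s n≤i)

degreeBelow-divK : ∀ {n} p → DegreeBelow (suc n) p → DegreeBelow n (divK p)
degreeBelow-divK []      hp i n≤i = refl
degreeBelow-divK (x ∷ p) hp i n≤i = hp (suc i) (s≤s n≤i)

degreeBelow0-∷ : ∀ p → DegreeBelow 0 p → DegreeBelow 0 (0ℤ ∷ p)
degreeBelow0-∷ p hp zero    _ = refl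
degreeBelow0-∷ p hp (suc i) _ = hp i z≤n

degreeBelow0-⊗ : ∀ p q → DegreeBelow 0 p → DegreeBelow 0 (p ⊗ q)
degreeBelow0-⊗ []      q hp i _ = refl
degreeBelow0-⊗ (x ∷ p) q hp i _ = begin
  coeff ((x ∷ p) ⊗ q) i                  ≡⟨ coeff-∷⊗ x p q i ⟩
  x * coeff q i + coeff (0ℤ ∷ (p ⊗ q)) i ≡⟨ cong₂ _+_ x*q≡0 (degreeBelow0-∷ (p ⊗ q) p⊗q≡0 i z≤n) ⟩
  0ℤ                                     ∎
  where
  x*q≡0 = trans (cong (_* coeff q i) (hp zero z≤n)) (*-zeroˡ (coeff q i))
  p⊗q≡0 = degreeBelow0-⊗ p q (degreeBelow-tail x p hp)

degreeBelow-⊗ : ∀ m {n} p q → DegreeBelow (suc m) p → DegreeBelow n q → DegreeBelow (m ℕ.+ n) (p ⊗ q)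
degreeBelow-⊗ m       []      q hp hq i _ = refl
degreeBelow-⊗ zero    (x ∷ p) q hp hq =
  degreeBelow-⊕ (scale x q) (0ℤ ∷ (p ⊗ q)) (degreeBelow-scale x q hq)
    (degreeBelow-mono (0ℤ ∷ (p ⊗ q)) z≤n (degreeBelow0-∷ (p ⊗ q) (degreeBelow0-⊗ p q (degreeBelow-tail x p hp))))
degreeBelow-⊗ (suc m) (x ∷ p) q hp hq =
  degreeBelow-⊕ (scale x q) (0ℤ ∷ (p ⊗ q))
    (degreeBelow-mono (scale x q) (m≤n+m _ (suc m)) (degreeBelow-scale x q hq))
    (degreeBelow-∷ 0ℤ (p ⊗ q) (degreeBelow-⊗ m p q (degreeBelow-tail x p hp) hq))

coeff-⊗-top : ∀ m n p q → DegreeBelow (suc m) p → DegreeBelow (suc n) q →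
              coeff (p ⊗ q) (m ℕ.+ n) ≡ coeff p m * coeff q n
coeff-⊗-top m       n []      q hp hq = sym (*-zeroˡ (coeff q n))
coeff-⊗-top zero    n (x ∷ p) q hp hq = begin
  coeff ((x ∷ p) ⊗ q) n                  ≡⟨ coeff-∷⊗ x p q n ⟩
  x * coeff q n + coeff (0ℤ ∷ (p ⊗ q)) n ≡⟨ cong (x * coeff q n +_) (degreeBelow0-∷ (p ⊗ q) p⊗q≡0 n z≤n) ⟩
  x * coeff q n + 0ℤ                     ≡⟨ +-identityʳ (x * coeff q n) ⟩
  x * coeff q n                          ∎
  where p⊗q≡0 = degreeBelow0-⊗ p q (degreeBelow-tail x p hp)
coeff-⊗-top (suc m) n (x ∷ p) q hp hq = begin
  coeff ((x ∷ p) ⊗ q) (suc (m ℕ.+ n))                   ≡⟨ coeff-∷⊗ x p q (suc (m ℕ.+ n)) ⟩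
  x * coeff q (suc (m ℕ.+ n)) + coeff (p ⊗ q) (m ℕ.+ n) ≡⟨ cong₂ _+_ x*q≡0 (coeff-⊗-top m n p q (degreeBelow-tail x p hp) hq) ⟩
  0ℤ + coeff p m * coeff q n                            ≡⟨ +-identityˡ _ ⟩
  coeff p m * coeff q n                                 ∎
  where x*q≡0 = trans (cong (x *_) (hq (suc (m ℕ.+ n)) (s≤s (m≤n+m n m)))) (*-zeroʳ x)

lead-zero : ∀ p → DegreeBelow 0 p → lead p ≡ 0ℤ
lead-zero []      hp = refl
lead-zero (a ∷ p) hp with lead p ≟ℤ 0ℤ
... | yes _   = hp zero z≤n
... | no  p≢0 = contradiction (lead-zero p (degreeBelow-tail a p hp)) p≢0

lead≡coeff : ∀ d p → DegreeBelow (suc d) p → coeff p d ≢ 0ℤ → lead p ≡ coeff p d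
lead≡coeff d       []      hp c≢0 = contradiction refl c≢0
lead≡coeff zero    (a ∷ p) hp c≢0 with lead p ≟ℤ 0ℤ
... | yes _   = refl
... | no  p≢0 = contradiction (lead-zero p (degreeBelow-tail a p hp)) p≢0
lead≡coeff (suc d) (a ∷ p) hp c≢0 with lead p ≟ℤ 0ℤ
... | yes p≡0 = contradiction (trans (sym (lead≡coeff d p (degreeBelow-tail a p hp) c≢0)) p≡0) c≢0
... | no  _   = lead≡coeff d p (degreeBelow-tail a p hp) c≢0

record Dominates (d e : Poly) : Set where
  field
    r       : ℕ
    d-below : DegreeBelow (suc (suc r)) d
    top≢0   : coeff d (suc r) ≢ 0ℤ
    e-below : DegreeBelow (suc r) e

  top : ℤ
  top = coeff d (suc r)

  lead≡top : lead d ≡ top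
  lead≡top = lead≡coeff (suc r) d d-below top≢0

module _ {d e : Poly} (D : Dominates d e) where
  open Dominates D

  private
    r′ : ℕ
    r′ = r ℕ.+ suc r

    d⊗d-below : DegreeBelow (suc (suc r′)) (d ⊗ d)
    d⊗d-below = degreeBelow-mono (d ⊗ d) (≤-reflexive (cong suc (+-suc r (suc r))))
                  (degreeBelow-⊗ (suc r) d d d-below d-below)

    e⊗e-below : DegreeBelow r′ (e ⊗ e)
    e⊗e-below = degreeBelow-⊗ r e e e-below e-below

    top-step : coeff ((d ⊗ d) ⊕ (e ⊗ e)) (suc r′) ≡ top * top
    top-step = begin
      coeff ((d ⊗ d) ⊕ (e ⊗ e)) (suc r′)              ≡⟨ coeff-⊕ (d ⊗ d) (e ⊗ e) (suc r′) ⟩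
      coeff (d ⊗ d) (suc r′) + coeff (e ⊗ e) (suc r′) ≡⟨ cong₂ _+_ (coeff-⊗-top (suc r) (suc r) d d d-below d-below)
                                                                   (e⊗e-below (suc r′) (n≤1+n r′)) ⟩
      top * top + 0ℤ                                  ≡⟨ +-identityʳ (top * top) ⟩
      top * top                                       ∎

  step-dominates : Dominates ((d ⊗ d) ⊕ (e ⊗ e)) (divK (d ⊗ e))
  step-dominates = record
    { r       = r′
    ; d-below = degreeBelow-⊕ (d ⊗ d) (e ⊗ e) d⊗d-below (degreeBelow-mono (e ⊗ e) (m≤n+m r′ 2) e⊗e-below)
    ; top≢0   = λ eq → [ top≢0 , top≢0 ]′ (i*j≡0⇒i≡0∨j≡0 top (trans (sym top-step) eq))
    ; e-below = degreeBelow-mono (divK (d ⊗ e)) (n≤1+n r′)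
                  (degreeBelow-divK (d ⊗ e) (degreeBelow-⊗ (suc r) d e d-below e-below))
    }

  lead-step : lead ((d ⊗ d) ⊕ (e ⊗ e)) ≡ lead d * lead d
  lead-step = begin
    lead ((d ⊗ d) ⊕ (e ⊗ e))           ≡⟨ Dominates.lead≡top step-dominates ⟩
    coeff ((d ⊗ d) ⊕ (e ⊗ e)) (suc r′) ≡⟨ top-step ⟩
    top * top                          ≡⟨ sym (cong₂ _*_ lead≡top lead≡top) ⟩
    lead d * lead d                    ∎

δε₁-dominates : Dominates twoK² kPoly
δε₁-dominates = record { r = 1 ; d-below = twoK²-below ; top≢0 = λ () ; e-below = kPoly-below }
  where
  twoK²-below : DegreeBelow 3 twoK²
  twoK²-below (suc (suc (suc i))) _              = refl
  twoK²-below (suc zero)          (s≤s ())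
  twoK²-below (suc (suc zero))    (s≤s (s≤s ()))
  kPoly-below : DegreeBelow 2 kPoly
  kPoly-below (suc (suc i)) _       = refl
  kPoly-below (suc zero)    (s≤s ())

-- δε (2 + m) unfolds definitionally to the recursion step applied to δε (1 + m).
δε-dominates : ∀ m → Dominates (δ (suc m)) (ε (suc m))
δε-dominates zero    = δε₁-dominates
δε-dominates (suc m) = step-dominates (δε-dominates m)

parity-suc : ∀ n → parity (suc n) ≡ parity n ⁻¹
parity-suc n = sym (⁻¹-selfInverse (suc-homo-⁻¹ n))

parity≡0ℙ⇒2∣ : ∀ n → parity n ≡ 0ℙ → 2 ∣ n
parity≡0ℙ⇒2∣ zero          _  = divides 0 refl
parity≡0ℙ⇒2∣ (suc zero)    ()
parity≡0ℙ⇒2∣ (suc (suc n)) eq = ∣m∣n⇒∣m+n (∣-refl {2}) (parity≡0ℙ⇒2∣ n eq)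

HasParity : Parity → Poly → Set
HasParity π p = ∀ i → parity i ≢ π → coeff p i ≡ 0ℤ

hasParity-⊕ : ∀ {π} p q → HasParity π p → HasParity π q → HasParity π (p ⊕ q)
hasParity-⊕ p q hp hq i ≢π = trans (coeff-⊕ p q i) (cong₂ _+_ (hp i ≢π) (hq i ≢π))

hasParity-scale : ∀ {π} c p → HasParity π p → HasParity π (scale c p)
hasParity-scale c p hp i ≢π = trans (coeff-scale c p i) (trans (cong (c *_) (hp i ≢π)) (*-zeroʳ c))

hasParity-0∷ : ∀ {π} p → HasParity π p → HasParity (π ⁻¹) (0ℤ ∷ p)
hasParity-0∷ p hp zero    _   = refl
hasParity-0∷ p hp (suc i) ≢π⁻¹ = hp i (λ ≡π → ≢π⁻¹ (trans (parity-suc i) (cong _⁻¹ ≡π)))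

hasParity-tail : ∀ {π} x p → HasParity π (x ∷ p) → HasParity (π ⁻¹) p
hasParity-tail x p hp i ≢π⁻¹ = hp (suc i) (λ ≡π → ≢π⁻¹ (trans (sym (suc-homo-⁻¹ i)) (cong _⁻¹ ≡π)))

hasParity-divK : ∀ {π} p → HasParity π p → HasParity (π ⁻¹) (divK p)
hasParity-divK []      hp i _ = refl
hasParity-divK (x ∷ p) hp     = hasParity-tail x p hp

hasParity-⊗ : ∀ π {ρ} p q → HasParity π p → HasParity ρ q → HasParity (π ℙ.+ ρ) (p ⊗ q)
hasParity-⊗ π  {ρ} []      q hp hq i _ = refl
hasParity-⊗ 0ℙ {ρ} (x ∷ p) q hp hq =
  hasParity-⊕ (scale x q) (0ℤ ∷ (p ⊗ q)) (hasParity-scale x q hq)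
    (subst (λ σ → HasParity σ (0ℤ ∷ (p ⊗ q))) (⁻¹-involutive ρ)
      (hasParity-0∷ (p ⊗ q) (hasParity-⊗ 1ℙ p q (hasParity-tail x p hp) hq)))
hasParity-⊗ 1ℙ {ρ} (x ∷ p) q hp hq =
  hasParity-⊕ (scale x q) (0ℤ ∷ (p ⊗ q)) x·q≡0
    (hasParity-0∷ (p ⊗ q) (hasParity-⊗ 0ℙ p q (hasParity-tail x p hp) hq))
  where
  x·q≡0 : HasParity (ρ ⁻¹) (scale x q)
  x·q≡0 i _ = trans (coeff-scale x q i) (trans (cong (_* coeff q i) (hp zero λ ())) (*-zeroˡ (coeff q i)))

step-parity : ∀ {π} d e → HasParity 0ℙ d → HasParity π e →
              HasParity 0ℙ ((d ⊗ d) ⊕ (e ⊗ e)) × HasParity (π ⁻¹) (divK (d ⊗ e))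
step-parity {π} d e hd he =
  hasParity-⊕ (d ⊗ d) (e ⊗ e) (hasParity-⊗ 0ℙ d d hd hd)
    (subst (λ σ → HasParity σ (e ⊗ e)) (p+p≡0ℙ π) (hasParity-⊗ π e e he he)) ,
  hasParity-divK (d ⊗ e) (hasParity-⊗ 0ℙ d e hd he)

δε-parity : ∀ m → HasParity 0ℙ (δ (suc m)) × HasParity (parity (suc m)) (ε (suc m))
δε-parity zero    = twoK²-even , kPoly-odd
  where
  twoK²-even : HasParity 0ℙ twoK²
  twoK²-even (suc (suc zero)) ≢0ℙ = contradiction refl ≢0ℙ
  twoK²-even zero                _ = refl
  twoK²-even (suc zero)          _ = refl
  twoK²-even (suc (suc (suc i))) _ = refl
  kPoly-odd : HasParity 1ℙ kPoly
  kPoly-odd (suc zero)    ≢1ℙ = contradiction refl ≢1ℙ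
  kPoly-odd zero          _   = refl
  kPoly-odd (suc (suc i)) _   = refl
δε-parity (suc m) =
  map₂ (subst (λ σ → HasParity σ (ε (suc (suc m)))) (sym (parity-suc (suc m))))
       (uncurry (step-parity (δ (suc m)) (ε (suc m))) (δε-parity m))

hasParity0ℙ⇒2∣ : ∀ p → HasParity 0ℙ p → ∀ i → coeff p i ≢ 0ℤ → 2 ∣ i
hasParity0ℙ⇒2∣ p hp i coeff≢0 with parity i ≟ℙ 0ℙ
... | yes even = parity≡0ℙ⇒2∣ i even
... | no  odd  = contradiction (hp i odd) coeff≢0

lemma21 : ((n : ℕ) → 2 ≤ n → ∃ λ (m : ℤ) → lead (δ n) ≡ m * m)
          × ((n : ℕ) → 1 ≤ n → (i : ℕ) → coeff (δ n) i ≢ 0ℤ → 2 ∣ i)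
lemma21 = lead-square , even-support
  where
  lead-square : (n : ℕ) → 2 ≤ n → ∃ λ (m : ℤ) → lead (δ n) ≡ m * m
  lead-square (suc (suc n)) _        = lead (δ (suc n)) , lead-step (δε-dominates n)
  lead-square (suc zero)    (s≤s ())
  even-support : (n : ℕ) → 1 ≤ n → (i : ℕ) → coeff (δ n) i ≢ 0ℤ → 2 ∣ i
  even-support (suc n) _ = hasParity0ℙ⇒2∣ (δ (suc n)) (proj₁ (δε-parity n))
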